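{- Let $p$ be a prime, $k$ a positive integer, and $a\leq d$ positive integers. Then $\mathfrak{s}_{\leq k}(\mathbb{Z}_p^d)\leq\frac{p^d-1}{p^a-1}\big(\mathfrak{s}_{\leq k}(\mathbb{Z}_p^a)-1\big)+1$.
   Context: $\mathbb{Z}_p=\mathbb{Z}/p\mathbb{Z}$. For a finite abelian group $G$, $\mathfrak{s}_{\leq k}(G)$ is the least integer $t$ such that every sequence of length $t$ in $G$ contains a zero-sum subsequence (a choice of $\ell\ge 1$ distinct indices with terms summing to $0$) of length $\ell\leq k$. -}

module Defs where

open import Data.Nat using (ℕ; zero; suc; _+_; _≤_)
open import Data.Nat.Divisibility using (_∣_)
open import Data.Fin using (Fin; toℕ) renaming (zero to fzero; suc to fsuc)
open import Data.Fin.Subset using (Subset; ∣_∣; inside; outside)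
open import Data.Vec using (_∷_; [])
open import Data.Bool using (true; false)
open import Data.Product using (Σ; _×_)

Zp^ : ℕ → ℕ → Set
Zp^ p d = Fin d → Fin p

sumOver : {t : ℕ} → Subset t → (Fin t → ℕ) → ℕ
sumOver {zero} [] f = 0
sumOver {suc t} (inside ∷ S) f = f fzero + sumOver S (λ i → f (fsuc i))
sumOver {suc t} (outside ∷ S) f = sumOver S (λ i → f (fsuc i))

-- The sequence x (of length t in Z_p^d) has a zero-sum subsequence of
-- length ℓ with 1 ≤ ℓ ≤ k: a nonempty set S of indices, |S| ≤ k, whose
-- terms sum to 0 in Z_p^d (i.e. every coordinate sum is divisible by p).
HasShortZeroSum : (p d k t : ℕ) → (Fin t → Zp^ p d) → Set
HasShortZeroSum p d k t x =
  Σ (Subset t) λ S → (1 ≤ ∣ S ∣) × (∣ S ∣ ≤ k) ×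
    ((j : Fin d) → p ∣ sumOver S (λ i → toℕ (x i j)))

AllHaveShortZeroSum : (p d k t : ℕ) → Set
AllHaveShortZeroSum p d k t = (x : Fin t → Zp^ p d) → HasShortZeroSum p d k t x

IsSmallDavenport≤ : (p d k s : ℕ) → Set
IsSmallDavenport≤ p d k s =
  AllHaveShortZeroSum p d k s × ((t : ℕ) → AllHaveShortZeroSum p d k t → s ≤ t)

module Submission where

-- Hyperplane step (dimension d to d + 1): assume length-N sequences in Z_p^d have short
-- zero-sums whenever A < N·B, and let x be a length-N sequence in Z_p^(d+1) without zero
-- terms.  For a linear form f let ker f = {i : f·x_i ≡ 0}.  Each x_i is killed by p^d
-- forms, so the kernels have total size ≥ N·p^d.  If a nonzero f has A < B·|ker f|, the
-- kernel terms lie in the hyperplane f = 0: dropping a coordinate j with f_j ≢ 0 gives a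
-- short zero-sum in Z_p^d, and f·σ ≡ 0 makes the dropped coordinate of its sum vanish.
-- Otherwise averaging over all forms contradicts (p^(d+1) - 1)·A < N·B·(p^d - 1).
-- Iterating from d = a gives the threshold (p^d - 1)(𝔰_a - 1) < N (p^a - 1); having short
-- zero-sums is decidable, so 𝔰_d exists as a least element and lies below that threshold.

open import Defs
open import Data.Nat using (ℕ; _∸_; _*_; _^_; _≤_)
open import Data.Nat.Primality using (Prime)
open import Data.Product using (Σ; _×_)

open import Data.Nat using (zero; suc; _+_; _<_; z≤n; s≤s; NonZero; _≤?_; _%_; _/_;
  _≤′_; ≤′-refl; ≤′-step; >-nonZero; nonTrivial⇒n>1)
open import Data.Nat.Properties
open import Data.Nat.Divisibility using (_∣_; _∣?_; divides; _∣0; ∣-trans; ∣m∣n⇒∣m+n;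
  ∣m+n∣m⇒∣n; n∣m*n; ∣⇒≤)
open import Data.Nat.DivMod using (_mod_; m%n<n; m≡m%n+[m/n]*n)
open import Data.Nat.Primality using (euclidsLemma; prime⇒nonZero; prime⇒nonTrivial)
open import Data.Nat.Coprimality using (prime⇒coprime; coprime-Bézout)
open import Data.Nat.GCD using (module Bézout)
open import Data.Nat.Tactic.RingSolver using (solve-∀)
open import Data.Bool using (Bool; true; false; _∧_) renaming (_≟_ to _≟ᵇ_)
open import Data.Bool.Properties using (¬-not)
open import Data.Fin using (Fin; toℕ; punchIn; punchOut)
  renaming (zero to fzero; suc to fsuc)
open import Data.Fin.Properties using (any?; toℕ<n; toℕ-fromℕ<; punchIn-punchOut)
  renaming (all? to allFin?; _≟_ to _≟ᶠ_)
open import Data.Fin.Subset using (Subset; ∣_∣; inside; outside; ⁅_⁆) renaming (⊥ to ∅)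
open import Data.Fin.Subset.Properties using (∣p∣≤n; ∣⁅x⁆∣≡1; anySubset?)
open import Data.Vec using (_∷_; [])
open import Data.Vec.Functional using () renaming (_∷_ to _∷ᵛ_)
open import Data.Product using (_,_)
open import Data.Sum using (_⊎_; inj₁; inj₂; map₂)
open import Data.Empty using (⊥; ⊥-elim)
open import Function using (_∘_)
open import Relation.Nullary using (Dec; yes; no; ¬_)
open import Relation.Nullary.Decidable using (isYes; map′; _×-dec_)
open import Relation.Binary.PropositionalEquality
open import Algebra.Properties.CommutativeMonoid.Sum +-0-commutativeMonoid
  using (sum; sum-syntax; sum-cong-≗; ∑-distrib-+; ∑-comm; sum-remove)
open import Algebra.Properties.Semiring.Sum +-*-semiring using (*-distribˡ-sum)


∑-const : ∀ n c → ∑[ i < n ] c ≡ n * c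
∑-const zero c = refl
∑-const (suc n) c = cong (c +_) (∑-const n c)

∑-mono : ∀ {n} {f g : Fin n → ℕ} → (∀ i → f i ≤ g i) → sum f ≤ sum g
∑-mono {zero} f≤g = z≤n
∑-mono {suc n} f≤g = +-mono-≤ (f≤g fzero) (∑-mono (f≤g ∘ fsuc))

term≤∑ : ∀ {n} (f : Fin n → ℕ) i → f i ≤ sum f
term≤∑ {suc n} f i = subst (f i ≤_) (sym (sum-remove {i = i} f)) (m≤m+n (f i) _)

∑-witness-or-mono : ∀ {n} {G : Fin n → Set} (f g : Fin n → ℕ) →
  (∀ i → G i ⊎ f i ≤ g i) → Σ (Fin n) G ⊎ sum f ≤ sum g
∑-witness-or-mono {zero} f g alt = inj₂ z≤n
∑-witness-or-mono {suc n} f g alt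
  with alt fzero | ∑-witness-or-mono (f ∘ fsuc) (g ∘ fsuc) (alt ∘ fsuc)
... | inj₁ G₀ | _ = inj₁ (fzero , G₀)
... | inj₂ _ | inj₁ (i , Gᵢ) = inj₁ (fsuc i , Gᵢ)
... | inj₂ f₀≤g₀ | inj₂ ∑f≤∑g = inj₂ (+-mono-≤ f₀≤g₀ ∑f≤∑g)

∑-divisible : ∀ {p n} (f : Fin n → ℕ) → (∀ i → p ∣ f i) → p ∣ sum f
∑-divisible {p} {zero} f p∣f = p ∣0
∑-divisible {p} {suc n} f p∣f = ∣m∣n⇒∣m+n (p∣f fzero) (∑-divisible (f ∘ fsuc) (p∣f ∘ fsuc))

infix 7 _·_
_·_ : ∀ {n} → (Fin n → ℕ) → (Fin n → ℕ) → ℕ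
u · v = sum (λ m → u m * v m)

bit : Bool → ℕ
bit true = 1
bit false = 0

𝟙[_∣_] : ℕ → ℕ → ℕ
𝟙[ p ∣ n ] = bit (isYes (p ∣? n))

𝟙-yes : ∀ {p n} → p ∣ n → 𝟙[ p ∣ n ] ≡ 1
𝟙-yes {p} {n} p∣n with p ∣? n
... | yes _ = refl
... | no p∤n = ⊥-elim (p∤n p∣n)

sumOver-cong : ∀ {t} (S : Subset t) {f g : Fin t → ℕ} → (∀ i → f i ≡ g i) →
  sumOver S f ≡ sumOver S g
sumOver-cong [] f≗g = refl
sumOver-cong (inside ∷ S) f≗g = cong₂ _+_ (f≗g fzero) (sumOver-cong S (f≗g ∘ fsuc))
sumOver-cong (outside ∷ S) f≗g = sumOver-cong S (f≗g ∘ fsuc)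

sumOver-divisible : ∀ {p t} (S : Subset t) (f : Fin t → ℕ) → (∀ i → p ∣ f i) →
  p ∣ sumOver S f
sumOver-divisible {p} [] f p∣f = p ∣0
sumOver-divisible (inside ∷ S) f p∣f =
  ∣m∣n⇒∣m+n (p∣f fzero) (sumOver-divisible S (f ∘ fsuc) (p∣f ∘ fsuc))
sumOver-divisible (outside ∷ S) f p∣f = sumOver-divisible S (f ∘ fsuc) (p∣f ∘ fsuc)

sumOver-∅ : ∀ {t} (f : Fin t → ℕ) → sumOver ∅ f ≡ 0
sumOver-∅ {zero} f = refl
sumOver-∅ {suc t} f = sumOver-∅ (f ∘ fsuc)

sumOver-⁅⁆ : ∀ {t} (i : Fin t) (f : Fin t → ℕ) → sumOver ⁅ i ⁆ f ≡ f i
sumOver-⁅⁆ fzero f = trans (cong (f fzero +_) (sumOver-∅ (f ∘ fsuc))) (+-identityʳ _)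
sumOver-⁅⁆ (fsuc i) f = sumOver-⁅⁆ i (f ∘ fsuc)

·-sumOver : ∀ {n t} (u : Fin n → ℕ) (S : Subset t) (X : Fin t → Fin n → ℕ) →
  u · (λ m → sumOver S (λ i → X i m)) ≡ sumOver S (λ i → u · X i)
·-sumOver {n} u [] X = begin
  u · (λ _ → 0)   ≡⟨ sum-cong-≗ (λ m → *-zeroʳ (u m)) ⟩
  ∑[ m < n ] 0    ≡⟨ ∑-const n 0 ⟩
  n * 0           ≡⟨ *-zeroʳ n ⟩
  0               ∎
  where open ≡-Reasoning
·-sumOver u (inside ∷ S) X = begin
  u · (λ m → X fzero m + rest m)
    ≡⟨ sum-cong-≗ (λ m → *-distribˡ-+ (u m) (X fzero m) (rest m)) ⟩
  sum (λ m → u m * X fzero m + u m * rest m)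
    ≡⟨ ∑-distrib-+ (λ m → u m * X fzero m) (λ m → u m * rest m) ⟩
  u · X fzero + u · rest
    ≡⟨ cong (u · X fzero +_) (·-sumOver u S (X ∘ fsuc)) ⟩
  u · X fzero + sumOver S (λ i → u · X (fsuc i)) ∎
  where
  open ≡-Reasoning
  rest = λ m → sumOver S (λ i → X (fsuc i) m)
·-sumOver u (outside ∷ S) X = ·-sumOver u S (X ∘ fsuc)

-- Subsequences.  A subset T of the indices is itself enumerated by Fin ∣ T ∣: emb T is
-- the enumeration, and expand T turns a subset of T into a subset of all indices.

emb : ∀ {N} (T : Subset N) → Fin ∣ T ∣ → Fin N
emb (inside ∷ T) fzero = fzero
emb (inside ∷ T) (fsuc i) = fsuc (emb T i)
emb (outside ∷ T) i = fsuc (emb T i)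

expand : ∀ {N} (T : Subset N) → Subset ∣ T ∣ → Subset N
expand [] [] = []
expand (inside ∷ T) (b ∷ S) = b ∷ expand T S
expand (outside ∷ T) S = outside ∷ expand T S

expand-card : ∀ {N} (T : Subset N) (S : Subset ∣ T ∣) → ∣ expand T S ∣ ≡ ∣ S ∣
expand-card [] [] = refl
expand-card (inside ∷ T) (inside ∷ S) = cong suc (expand-card T S)
expand-card (inside ∷ T) (outside ∷ S) = expand-card T S
expand-card (outside ∷ T) S = expand-card T S

expand-sum : ∀ {N} (T : Subset N) (S : Subset ∣ T ∣) (f : Fin N → ℕ) →
  sumOver (expand T S) f ≡ sumOver S (f ∘ emb T)
expand-sum [] [] f = refl
expand-sum (inside ∷ T) (inside ∷ S) f = cong (f fzero +_) (expand-sum T S (f ∘ fsuc))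
expand-sum (inside ∷ T) (outside ∷ S) f = expand-sum T S (f ∘ fsuc)
expand-sum (outside ∷ T) S f = expand-sum T S (f ∘ fsuc)

zeroSum-restrict : ∀ {p d k N} (T : Subset N) (x : Fin N → Zp^ p d) →
  HasShortZeroSum p d k ∣ T ∣ (x ∘ emb T) → HasShortZeroSum p d k N x
zeroSum-restrict {p} T x (S , 1≤∣S∣ , ∣S∣≤k , zero-sum) =
  expand T S ,
  subst (1 ≤_) (sym (expand-card T S)) 1≤∣S∣ ,
  subst (_≤ _) (sym (expand-card T S)) ∣S∣≤k ,
  λ j → subst (p ∣_) (sym (expand-sum T S (λ i → toℕ (x i j)))) (zero-sum j)

subsetOfSize : ∀ {s N} → s ≤ N → Σ (Subset N) λ T → ∣ T ∣ ≡ s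
subsetOfSize {N = zero} z≤n = [] , refl
subsetOfSize {zero} {suc N} z≤n with subsetOfSize {0} {N} z≤n
... | T , ∣T∣≡0 = outside ∷ T , ∣T∣≡0
subsetOfSize {suc s} {suc N} (s≤s s≤N) with subsetOfSize s≤N
... | T , ∣T∣≡s = inside ∷ T , cong suc ∣T∣≡s

allHave-mono : ∀ {p d k s N} → s ≤ N →
  AllHaveShortZeroSum p d k s → AllHaveShortZeroSum p d k N
allHave-mono s≤N allₛ x with subsetOfSize s≤N
... | T , refl = zeroSum-restrict T x (allₛ (x ∘ emb T))

zeroTerm : ∀ {p d k N} → 1 ≤ k → (x : Fin N → Zp^ p d) (i : Fin N) →
  (∀ j → toℕ (x i j) ≡ 0) → HasShortZeroSum p d k N x
zeroTerm {p} k≥1 x i xᵢ≡0 =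
  ⁅ i ⁆ ,
  ≤-reflexive (sym (∣⁅x⁆∣≡1 i)) ,
  subst (_≤ _) (sym (∣⁅x⁆∣≡1 i)) k≥1 ,
  λ j → subst (p ∣_) (sym (trans (sumOver-⁅⁆ i (λ i′ → toℕ (x i′ j))) (xᵢ≡0 j))) (p ∣0)

select : ∀ {N} {P : Fin N → Set} → (∀ i → Dec (P i)) → Subset N
select {zero} P? = []
select {suc N} P? = isYes (P? fzero) ∷ select (P? ∘ fsuc)

select-card : ∀ {N} {P : Fin N → Set} (P? : ∀ i → Dec (P i)) →
  ∣ select P? ∣ ≡ ∑[ i < N ] bit (isYes (P? i))
select-card {zero} P? = refl
select-card {suc N} P? with P? fzero
... | yes _ = cong suc (select-card (P? ∘ fsuc))
... | no _ = select-card (P? ∘ fsuc)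

select-member : ∀ {N} {P : Fin N → Set} (P? : ∀ i → Dec (P i)) (i : Fin ∣ select P? ∣) →
  P (emb (select P?) i)
select-member {suc N} P? i with P? fzero
select-member {suc N} P? fzero | yes P₀ = P₀
select-member {suc N} P? (fsuc i) | yes _ = select-member (P? ∘ fsuc) i
... | no _ = select-member (P? ∘ fsuc) i

-- A type is exhaustible if
-- every decidable predicate respecting a chosen equivalence can be checked on all of it;
-- Fin n is, and exhaustibility passes to vectors Fin n → A (with pointwise equivalence,
-- which avoids function extensionality).

record Exhaustible (A : Set) : Set₁ where
  field
    _≈_ : A → A → Set
    ≈-refl : ∀ {a} → a ≈ a
    ∀? : ∀ {P : A → Set} → (∀ {a b} → a ≈ b → P a → P b) → (∀ a → Dec (P a)) →
      Dec (∀ a → P a)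

exhaustibleFin : ∀ n → Exhaustible (Fin n)
exhaustibleFin n = record { _≈_ = _≡_ ; ≈-refl = refl ; ∀? = λ _ P? → allFin? P? }

exhaustibleVector : ∀ {A} → Exhaustible A → ∀ n → Exhaustible (Fin n → A)
exhaustibleVector {A} E n =
  record { _≈_ = Pointwise ; ≈-refl = λ _ → ≈-refl ; ∀? = λ resp → search n resp }
  where
  open Exhaustible E
  Pointwise : ∀ {n} → (Fin n → A) → (Fin n → A) → Set
  Pointwise u v = ∀ i → u i ≈ v i
  search : ∀ n {P : (Fin n → A) → Set} → (∀ {u v} → Pointwise u v → P u → P v) →
    (∀ v → Dec (P v)) → Dec (∀ v → P v)
  search zero resp P? = map′ (λ Pnil v → resp (λ ()) Pnil) (λ ∀P → ∀P nil) (P? nil)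
    where
    nil : Fin 0 → A
    nil ()
  search (suc n) {P} resp P? =
    map′ (λ ∀P∷ v → resp (λ { fzero → ≈-refl ; (fsuc i) → ≈-refl })
                          (∀P∷ (v fzero) (v ∘ fsuc)))
         (λ ∀P a g → ∀P (a ∷ᵛ g))
         (∀? respHead (λ a → search n (respTail a) (λ g → P? (a ∷ᵛ g))))
    where
    respHead : ∀ {a b} → a ≈ b → (∀ g → P (a ∷ᵛ g)) → ∀ g → P (b ∷ᵛ g)
    respHead a≈b ∀P g = resp (λ { fzero → a≈b ; (fsuc i) → ≈-refl }) (∀P g)
    respTail : ∀ a {g h} → Pointwise g h → P (a ∷ᵛ g) → P (a ∷ᵛ h)
    respTail a g≈h = resp (λ { fzero → ≈-refl ; (fsuc i) → g≈h i })

hasShortZeroSum? : ∀ p d k t (x : Fin t → Zp^ p d) → Dec (HasShortZeroSum p d k t x)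
hasShortZeroSum? p d k t x = anySubset? λ S →
  (1 ≤? ∣ S ∣) ×-dec (∣ S ∣ ≤? k) ×-dec allFin? (λ j → p ∣? sumOver S (λ i → toℕ (x i j)))

allHaveShortZeroSum? : ∀ p d k t → Dec (AllHaveShortZeroSum p d k t)
allHaveShortZeroSum? p d k t =
  Exhaustible.∀? (exhaustibleVector (exhaustibleVector (exhaustibleFin p) d) t)
    respects (hasShortZeroSum? p d k t)
  where
  respects : ∀ {x y : Fin t → Zp^ p d} → (∀ i j → x i j ≡ y i j) →
    HasShortZeroSum p d k t x → HasShortZeroSum p d k t y
  respects x≈y (S , 1≤∣S∣ , ∣S∣≤k , zero-sum) = S , 1≤∣S∣ , ∣S∣≤k ,
    λ j → subst (p ∣_) (sumOver-cong S (λ i → cong toℕ (x≈y i j))) (zero-sum j)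

IsLeast : (ℕ → Set) → ℕ → Set
IsLeast P s = P s × (∀ t → P t → s ≤ t)

leastOrNoneBelow : ∀ {P : ℕ → Set} → (∀ n → Dec (P n)) → ∀ n →
  Σ ℕ (IsLeast P) ⊎ (∀ t → t < n → ¬ P t)
leastOrNoneBelow P? zero = inj₂ (λ _ ())
leastOrNoneBelow {P} P? (suc n) with leastOrNoneBelow P? n
... | inj₁ least = inj₁ least
... | inj₂ none with P? n
...   | yes Pn = inj₁ (n , Pn , λ t Pt → ≮⇒≥ (λ t<n → none t t<n Pt))
...   | no ¬Pn = inj₂ noneUpTo
  where
  noneUpTo : ∀ t → t < suc n → ¬ P t
  noneUpTo t t<1+n Pt with m<1+n⇒m<n∨m≡n t<1+n
  ... | inj₁ t<n = none t t<n Pt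
  ... | inj₂ refl = ¬Pn Pt

leastBelowThreshold : ∀ {P : ℕ → Set} → (∀ n → Dec (P n)) → ∀ X B → 1 ≤ B →
  (∀ N → X < N * B → P N) → Σ ℕ λ s → IsLeast P s × ((s ∸ 1) * B ≤ X)
leastBelowThreshold {P} P? X B B≥1 beyond with leastOrNoneBelow P? (suc (suc X))
... | inj₁ (s , Ps , min) = s , (Ps , min) , below s min
  where
  below : ∀ s → (∀ t → P t → s ≤ t) → (s ∸ 1) * B ≤ X
  below zero _ = z≤n
  below (suc s) min = ≮⇒≥ (λ X<sB → 1+n≰n (min s (beyond s X<sB)))
... | inj₂ none = ⊥-elim (none (suc X) ≤-refl (beyond (suc X) X<[1+X]B))
  where
  X<[1+X]B : X < suc X * B
  X<[1+X]B = ≤-trans (≤-reflexive (sym (*-identityʳ (suc X)))) (*-monoʳ-≤ (suc X) B≥1)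

module Vectors (p : ℕ) where

  ∑V : ∀ n → ((Fin n → Fin p) → ℕ) → ℕ
  ∑V zero h = h (λ ())
  ∑V (suc n) h = ∑[ c < p ] ∑V n (λ g → h (c ∷ᵛ g))

  ∑V-cong : ∀ n {h h′ : (Fin n → Fin p) → ℕ} → (∀ f → h f ≡ h′ f) → ∑V n h ≡ ∑V n h′
  ∑V-cong zero h≗h′ = h≗h′ _
  ∑V-cong (suc n) h≗h′ = sum-cong-≗ {p} (λ c → ∑V-cong n (λ g → h≗h′ (c ∷ᵛ g)))

  ∑V-mono : ∀ n {h h′ : (Fin n → Fin p) → ℕ} → (∀ f → h f ≤ h′ f) → ∑V n h ≤ ∑V n h′
  ∑V-mono zero h≤h′ = h≤h′ _
  ∑V-mono (suc n) h≤h′ = ∑-mono (λ c → ∑V-mono n (λ g → h≤h′ (c ∷ᵛ g)))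

  ∑V-+ : ∀ n (u v : (Fin n → Fin p) → ℕ) → ∑V n (λ f → u f + v f) ≡ ∑V n u + ∑V n v
  ∑V-+ zero u v = refl
  ∑V-+ (suc n) u v = trans (sum-cong-≗ {p} (λ c → ∑V-+ n (u ∘ (c ∷ᵛ_)) (v ∘ (c ∷ᵛ_))))
    (∑-distrib-+ (λ c → ∑V n (u ∘ (c ∷ᵛ_))) (λ c → ∑V n (v ∘ (c ∷ᵛ_))))

  ∑V-*ˡ : ∀ n c (u : (Fin n → Fin p) → ℕ) → ∑V n (λ f → c * u f) ≡ c * ∑V n u
  ∑V-*ˡ zero c u = refl
  ∑V-*ˡ (suc n) c u = trans (sum-cong-≗ {p} (λ c′ → ∑V-*ˡ n c (u ∘ (c′ ∷ᵛ_))))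
    (sym (*-distribˡ-sum c (λ c′ → ∑V n (u ∘ (c′ ∷ᵛ_)))))

  ∑V-const : ∀ n c → ∑V n (λ _ → c) ≡ p ^ n * c
  ∑V-const zero c = sym (+-identityʳ c)
  ∑V-const (suc n) c = begin
    ∑[ c′ < p ] ∑V n (λ _ → c)  ≡⟨ sum-cong-≗ {p} (λ _ → ∑V-const n c) ⟩
    ∑[ c′ < p ] (p ^ n * c)     ≡⟨ ∑-const p (p ^ n * c) ⟩
    p * (p ^ n * c)             ≡⟨ *-assoc p (p ^ n) c ⟨
    p ^ suc n * c               ∎
    where open ≡-Reasoning

  ∑V-∑-comm : ∀ n {N} (h : (Fin n → Fin p) → Fin N → ℕ) →
    ∑V n (λ f → ∑[ i < N ] h f i) ≡ ∑[ i < N ] ∑V n (λ f → h f i)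
  ∑V-∑-comm zero h = refl
  ∑V-∑-comm (suc n) h =
    trans (sum-cong-≗ {p} (λ c → ∑V-∑-comm n (h ∘ (c ∷ᵛ_))))
          (∑-comm (λ c i → ∑V n (λ g → h (c ∷ᵛ g) i)))

  ∑V-witness-or-mono : ∀ n {G : (Fin n → Fin p) → Set} (h h′ : (Fin n → Fin p) → ℕ) →
    (∀ f → G f ⊎ h f ≤ h′ f) → Σ _ G ⊎ ∑V n h ≤ ∑V n h′
  ∑V-witness-or-mono zero h h′ alt with alt (λ ())
  ... | inj₁ G∅ = inj₁ (_ , G∅)
  ... | inj₂ h≤h′ = inj₂ h≤h′
  ∑V-witness-or-mono (suc n) h h′ alt
    with ∑-witness-or-mono _ _ (λ c → ∑V-witness-or-mono n (h ∘ (c ∷ᵛ_)) (h′ ∘ (c ∷ᵛ_))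
                                                      (alt ∘ (c ∷ᵛ_)))
  ... | inj₁ (c , g , Gc∷g) = inj₁ (c ∷ᵛ g , Gc∷g)
  ... | inj₂ ∑h≤∑h′ = inj₂ ∑h≤∑h′

  -- The zero vector, detected by a boolean test whose recursion matches ∑V.

  isZeroᶠ : ∀ {m} → Fin m → Bool
  isZeroᶠ fzero = true
  isZeroᶠ (fsuc _) = false

  isZero : ∀ {n} → (Fin n → Fin p) → Bool
  isZero {zero} f = true
  isZero {suc n} f = isZeroᶠ (f fzero) ∧ isZero (f ∘ fsuc)

  isZero-true : ∀ {n} (f : Fin n → Fin p) → isZero f ≡ true → ∀ j → toℕ (f j) ≡ 0
  isZero-true {suc n} f f≡0 j with f fzero in f₀≡c
  isZero-true {suc n} f f≡0 fzero | fzero = cong toℕ f₀≡c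
  isZero-true {suc n} f f≡0 (fsuc j) | fzero = isZero-true (f ∘ fsuc) f≡0 j

  isZero-false : ∀ {n} (f : Fin n → Fin p) → isZero f ≡ false →
    Σ (Fin n) λ j → toℕ (f j) ≢ 0
  isZero-false {suc n} f f≢0 with f fzero in f₀≡c
  ... | fsuc c = fzero , λ f₀≡0 → 0≢1+n (trans (sym f₀≡0) (cong toℕ f₀≡c))
  ... | fzero with isZero-false (f ∘ fsuc) f≢0
  ...   | j , fⱼ≢0 = fsuc j , fⱼ≢0

  ∑V-isZero : .{{NonZero p}} → ∀ n → ∑V n (bit ∘ isZero) ≡ 1
  ∑V-isZero zero = refl
  ∑V-isZero (suc n) = begin
    ∑[ c < p ] ∑V n (λ g → bit (isZeroᶠ c ∧ isZero g))
      ≡⟨ sum-cong-≗ {p} (λ c → ∑V-cong n (λ g → bit-∧ (isZeroᶠ c) (isZero g))) ⟩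
    ∑[ c < p ] ∑V n (λ g → bit (isZeroᶠ c) * bit (isZero g))
      ≡⟨ sum-cong-≗ {p} (λ c → ∑V-*ˡ n (bit (isZeroᶠ c)) (bit ∘ isZero)) ⟩
    ∑[ c < p ] (bit (isZeroᶠ c) * ∑V n (bit ∘ isZero))
      ≡⟨ sum-cong-≗ {p} (λ c → trans (cong (bit (isZeroᶠ c) *_) (∑V-isZero n))
                                    (*-identityʳ _)) ⟩
    ∑[ c < p ] bit (isZeroᶠ c)
      ≡⟨ oneZero p ⟩
    1 ∎
    where
    open ≡-Reasoning
    bit-∧ : ∀ b b′ → bit (b ∧ b′) ≡ bit b * bit b′
    bit-∧ true b′ = sym (+-identityʳ (bit b′))
    bit-∧ false b′ = refl
    oneZero : ∀ m → .{{NonZero m}} → ∑[ c < m ] bit (isZeroᶠ c) ≡ 1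
    oneZero (suc m) = cong suc (trans (∑-const m 0) (*-zeroʳ m))

  infix 7 _·ᵥ_
  _·ᵥ_ : ∀ {n} → (Fin n → Fin p) → (Fin n → Fin p) → ℕ
  f ·ᵥ v = (toℕ ∘ f) · (toℕ ∘ v)

  ker : ∀ {n N} → (Fin n → Fin p) → (Fin N → Fin n → Fin p) → Subset N
  ker f x = select (λ i → p ∣? f ·ᵥ x i)

  ker-card : ∀ {n N} (f : Fin n → Fin p) (x : Fin N → Fin n → Fin p) →
    ∣ ker f x ∣ ≡ ∑[ i < N ] 𝟙[ p ∣ f ·ᵥ x i ]
  ker-card f x = select-card (λ i → p ∣? f ·ᵥ x i)

-- Arithmetic modulo a prime p.

inverse : ∀ {p w} → Prime p → 0 < w → w < p → Σ ℕ λ c → p ∣ 1 + c * w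
inverse {suc p′} {w@(suc _)} isPrime _ w<p with coprime-Bézout (prime⇒coprime isPrime w<p)
... | Bézout.+- x y 1+yw≡xp = y , divides x 1+yw≡xp
... | Bézout.-+ x y 1+xp≡yw = p′ * y , divides (1 + p′ * x) (begin
  1 + p′ * y * w             ≡⟨ cong (1 +_) (*-assoc p′ y w) ⟩
  1 + p′ * (y * w)           ≡⟨ cong (λ z → 1 + p′ * z) 1+xp≡yw ⟨
  1 + p′ * (1 + x * suc p′)  ≡⟨ factor p′ x ⟩
  (1 + p′ * x) * suc p′      ∎)
  where
  open ≡-Reasoning
  factor : ∀ p′ x → 1 + p′ * (1 + x * suc p′) ≡ (1 + p′ * x) * suc p′
  factor = solve-∀

∣-reduce : ∀ {p} .{{_ : NonZero p}} r c w → p ∣ r + c * w → p ∣ r + c % p * w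
∣-reduce {p} r c w p∣r+cw = ∣m+n∣m⇒∣n (subst (p ∣_) split p∣r+cw) (n∣m*n (c / p * w))
  where
  rearrange : ∀ r a b p w → r + (a + b * p) * w ≡ b * w * p + (r + a * w)
  rearrange = solve-∀
  split : r + c * w ≡ c / p * w * p + (r + c % p * w)
  split = trans (cong (λ z → r + z * w) (m≡m%n+[m/n]*n c p))
                (rearrange r (c % p) (c / p) p w)

solveLinear : ∀ {p} → Prime p → ∀ r {w} → 0 < w → w < p → Σ (Fin p) λ c → p ∣ r + toℕ c * w
solveLinear {p} isPrime r {w} w>0 w<p with inverse isPrime w>0 w<p
... | c , p∣1+cw = (r * c) mod p ,
  subst (λ z → p ∣ r + z * w) (sym (toℕ-fromℕ< (m%n<n (r * c) p)))
    (∣-reduce r (r * c) w p∣r+rcw)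
  where
  instance
    p≢0 : NonZero p
    p≢0 = prime⇒nonZero isPrime
  p∣r+rcw : p ∣ r + r * c * w
  p∣r+rcw = subst (p ∣_) (factor r c w) (∣-trans p∣1+cw (n∣m*n r))
    where
    factor : ∀ r c w → r * (1 + c * w) ≡ r + r * c * w
    factor = solve-∀

isolateTerm : ∀ {p n} (u σ : Fin (suc n) → ℕ) j → p ∣ u · σ →
  (∀ m → p ∣ σ (punchIn j m)) → p ∣ u j * σ j
isolateTerm {p} u σ j p∣u·σ others =
  ∣m+n∣m⇒∣n (subst (p ∣_) (trans (sum-remove {i = j} t) (+-comm (t j) rest)) p∣u·σ) p∣rest
  where
  t = λ m → u m * σ m
  rest = sum (λ m → t (punchIn j m))
  p∣rest : p ∣ rest
  p∣rest = ∑-divisible _ (λ m → ∣-trans (others m) (n∣m*n (u (punchIn j m))))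

kernelCoordinate : ∀ {p n} → Prime p → (u σ : Fin (suc n) → ℕ) (j : Fin (suc n)) →
  0 < u j → u j < p → p ∣ u · σ → (∀ m → p ∣ σ (punchIn j m)) → ∀ m → p ∣ σ m
kernelCoordinate {p} isPrime u σ j uⱼ>0 uⱼ<p p∣u·σ others m with j ≟ᶠ m
... | no j≢m = subst (λ m → p ∣ σ m) (punchIn-punchOut j≢m) (others (punchOut j≢m))
... | yes refl with euclidsLemma (u j) (σ j) isPrime (isolateTerm u σ j p∣u·σ others)
...   | inj₂ p∣σⱼ = p∣σⱼ
...   | inj₁ p∣uⱼ = ⊥-elim (<⇒≱ uⱼ<p (∣⇒≤ {{>-nonZero uⱼ>0}} p∣uⱼ))

averaging-contradiction : ∀ {A B N P Q} → 1 ≤ P → 1 ≤ Q →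
  (Q ∸ 1) * A < N * B * (P ∸ 1) → B * (N * P) + A ≤ Q * A + N * B → ⊥
averaging-contradiction {A} {B} {N} {suc P} {suc Q} _ _ beyond bound =
  <⇒≱ (subst₂ _<_ (lhs A B N Q) (rhs A B N P) (+-monoˡ-< (A + N * B) beyond)) bound
  where
  lhs : ∀ A B N Q → Q * A + (A + N * B) ≡ suc Q * A + N * B
  lhs = solve-∀
  rhs : ∀ A B N P → N * B * P + (A + N * B) ≡ B * (N * suc P) + A
  rhs = solve-∀

-- The hyperplane step, over Z_p for a prime p.

module HyperplaneStep {p : ℕ} (isPrime : Prime p) where

  open Vectors p

  instance
    p≢0 : NonZero p
    p≢0 = prime⇒nonZero isPrime

  -- A nonzero v ∈ Z_p^(m+1) satisfies any congruence r + f·v ≡ 0 for at least p^m forms f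
  -- (solve for the coordinate of f at a position j where v_j ≢ 0).
  kernelCount : ∀ m (v : Fin (suc m) → Fin p) j → toℕ (v j) ≢ 0 → ∀ r →
    p ^ m ≤ ∑V (suc m) (λ f → 𝟙[ p ∣ r + f ·ᵥ v ])
  kernelCount m v fzero v₀≢0 r = begin
    p ^ m                                   ≡⟨ *-identityʳ (p ^ m) ⟨
    p ^ m * 1                               ≡⟨ ∑V-const m 1 ⟨
    ∑V m (λ _ → 1)                          ≤⟨ ∑V-mono m solvable ⟩
    ∑V m (λ g → ∑[ c < p ] hit c g)         ≡⟨ ∑V-∑-comm m (λ g c → hit c g) ⟩
    ∑V (suc m) (λ f → 𝟙[ p ∣ r + f ·ᵥ v ])  ∎
    where
    open ≤-Reasoning
    hit : Fin p → (Fin m → Fin p) → ℕ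
    hit c g = 𝟙[ p ∣ r + (c ∷ᵛ g) ·ᵥ v ]
    -- For each g the congruence is linear in the first coordinate c, so it is solvable.
    solvable : ∀ g → 1 ≤ ∑[ c < p ] hit c g
    solvable g
      with solveLinear isPrime (r + g ·ᵥ (v ∘ fsuc)) (n≢0⇒n>0 v₀≢0) (toℕ<n (v fzero))
    ... | c , p∣ = subst (_≤ ∑[ c < p ] hit c g) (𝟙-yes (subst (p ∣_) reorder p∣))
                         (term≤∑ (λ c → hit c g) c)
      where
      rest = g ·ᵥ (v ∘ fsuc)
      term = toℕ c * toℕ (v fzero)
      reorder : r + rest + term ≡ r + (term + rest)
      reorder = trans (+-assoc r rest term) (cong (r +_) (+-comm rest term))
  kernelCount (suc m) v (fsuc j) vⱼ≢0 r = begin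
    p ^ suc m                                       ≡⟨ ∑-const p (p ^ m) ⟨
    ∑[ c < p ] (p ^ m)                              ≤⟨ ∑-mono {p} shifted ⟩
    ∑[ c < p ] ∑V (suc m) (λ g → hit c g)           ∎
    where
    open ≤-Reasoning
    hit : Fin p → (Fin (suc m) → Fin p) → ℕ
    hit c g = 𝟙[ p ∣ r + (c ∷ᵛ g) ·ᵥ v ]
    -- Fixing the first coordinate c shifts the constant by c·v₀.
    shifted : ∀ c → p ^ m ≤ ∑V (suc m) (hit c)
    shifted c = ≤-trans (kernelCount m (v ∘ fsuc) j vⱼ≢0 (r + term))
      (≤-reflexive (∑V-cong (suc m) λ g →
        cong 𝟙[ p ∣_] (+-assoc r term (g ·ᵥ (v ∘ fsuc)))))
      where term = toℕ c * toℕ (v fzero)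

  kernelTotal : ∀ {d N} (x : Fin N → Zp^ p (suc d)) → (∀ i → isZero (x i) ≡ false) →
    N * p ^ d ≤ ∑V (suc d) (λ f → ∣ ker f x ∣)
  kernelTotal {d} {N} x nonzero = begin
    N * p ^ d                                  ≡⟨ ∑-const N (p ^ d) ⟨
    ∑[ i < N ] (p ^ d)                         ≤⟨ ∑-mono {N} killing ⟩
    ∑[ i < N ] ∑V (suc d) (λ f → kills f i)   ≡⟨ ∑V-∑-comm (suc d) kills ⟨
    ∑V (suc d) (λ f → ∑[ i < N ] kills f i)   ≡⟨ ∑V-cong (suc d) (λ f → ker-card f x) ⟨
    ∑V (suc d) (λ f → ∣ ker f x ∣)             ∎
    where
    open ≤-Reasoning
    kills : (Fin (suc d) → Fin p) → Fin N → ℕ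
    kills f i = 𝟙[ p ∣ f ·ᵥ x i ]
    killing : ∀ i → p ^ d ≤ ∑V (suc d) (λ f → kills f i)
    killing i with isZero-false (x i) (nonzero i)
    ... | j , xᵢⱼ≢0 = kernelCount d (x i) j xᵢⱼ≢0 0

  -- Averaging over all forms: either some nonzero form f has a large kernel
  -- (A < B·|ker f|), or the total kernel size is bounded by the small kernels
  -- (at most A/B each) and the zero form (kernel of size N).
  largeKernel-or-bound : ∀ {d N} (x : Fin N → Zp^ p (suc d)) (A B : ℕ) →
    Σ _ (λ f → isZero f ≡ false × A < B * ∣ ker f x ∣) ⊎
    B * ∑V (suc d) (λ f → ∣ ker f x ∣) + A ≤ p ^ suc d * A + N * B
  largeKernel-or-bound {d} {N} x A B =
    map₂ (subst₂ _≤_ ∑g ∑h) (∑V-witness-or-mono (suc d) g h alternative)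
    where
    K g h : (Fin (suc d) → Fin p) → ℕ
    K f = ∣ ker f x ∣
    g f = B * K f + A * bit (isZero f)
    h f = A + N * B * bit (isZero f)
    alternative : ∀ f → (isZero f ≡ false × A < B * K f) ⊎ g f ≤ h f
    alternative f with isZero f
    ... | true = inj₂ (begin
      B * K f + A * 1  ≡⟨ cong (B * K f +_) (*-identityʳ A) ⟩
      B * K f + A      ≡⟨ +-comm (B * K f) A ⟩
      A + B * K f      ≤⟨ +-monoʳ-≤ A (*-monoʳ-≤ B (∣p∣≤n (ker f x))) ⟩
      A + B * N        ≡⟨ cong (A +_) (trans (*-comm B N) (sym (*-identityʳ (N * B)))) ⟩
      A + N * B * 1    ∎)
      where open ≤-Reasoning
    ... | false with A <? B * K f
    ...   | yes large = inj₁ (refl , large)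
    ...   | no small = inj₂ (begin
      B * K f + A * 0  ≡⟨ cong (B * K f +_) (*-zeroʳ A) ⟩
      B * K f + 0      ≡⟨ +-identityʳ (B * K f) ⟩
      B * K f          ≤⟨ ≮⇒≥ small ⟩
      A                ≡⟨ +-identityʳ A ⟨
      A + 0            ≡⟨ cong (A +_) (*-zeroʳ (N * B)) ⟨
      A + N * B * 0    ∎)
      where open ≤-Reasoning
    ∑g : ∑V (suc d) g ≡ B * ∑V (suc d) K + A
    ∑g = begin
      ∑V (suc d) g
        ≡⟨ ∑V-+ (suc d) (λ f → B * K f) (λ f → A * bit (isZero f)) ⟩
      ∑V (suc d) (λ f → B * K f) + ∑V (suc d) (λ f → A * bit (isZero f))
        ≡⟨ cong₂ _+_ (∑V-*ˡ (suc d) B K) (∑V-*ˡ (suc d) A (bit ∘ isZero)) ⟩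
      B * ∑V (suc d) K + A * ∑V (suc d) (bit ∘ isZero)
        ≡⟨ cong (λ z → B * ∑V (suc d) K + A * z) (∑V-isZero (suc d)) ⟩
      B * ∑V (suc d) K + A * 1
        ≡⟨ cong (B * ∑V (suc d) K +_) (*-identityʳ A) ⟩
      B * ∑V (suc d) K + A
        ∎
      where open ≡-Reasoning
    ∑h : ∑V (suc d) h ≡ p ^ suc d * A + N * B
    ∑h = begin
      ∑V (suc d) h
        ≡⟨ ∑V-+ (suc d) (λ _ → A) (λ f → N * B * bit (isZero f)) ⟩
      ∑V (suc d) (λ _ → A) + ∑V (suc d) (λ f → N * B * bit (isZero f))
        ≡⟨ cong₂ _+_ (∑V-const (suc d) A) (∑V-*ˡ (suc d) (N * B) (bit ∘ isZero)) ⟩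
      p ^ suc d * A + N * B * ∑V (suc d) (bit ∘ isZero)
        ≡⟨ cong (λ z → p ^ suc d * A + N * B * z) (∑V-isZero (suc d)) ⟩
      p ^ suc d * A + N * B * 1
        ≡⟨ cong (p ^ suc d * A +_) (*-identityʳ (N * B)) ⟩
      p ^ suc d * A + N * B
        ∎
      where open ≡-Reasoning

  -- If the kernel of a nonzero form f is long enough to contain a short zero-sum in
  -- dimension d, then x has one: project the kernel terms to Z_p^d by dropping a
  -- coordinate j with f_j ≢ 0; the dropped coordinate of the sum vanishes by
  -- kernelCoordinate.
  zeroSumInKernel : ∀ {k d N} (x : Fin N → Zp^ p (suc d)) (f : Fin (suc d) → Fin p) →
    isZero f ≡ false → AllHaveShortZeroSum p d k ∣ ker f x ∣ →
    HasShortZeroSum p (suc d) k N x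
  zeroSumInKernel {k} {d} x f f≢0 allKer with isZero-false f f≢0
  ... | j , fⱼ≢0 = zeroSum-restrict T x (lift (allKer (λ i m → x (emb T i) (punchIn j m))))
    where
    T = ker f x
    lift : HasShortZeroSum p d k ∣ T ∣ (λ i m → x (emb T i) (punchIn j m)) →
      HasShortZeroSum p (suc d) k ∣ T ∣ (x ∘ emb T)
    lift (S , 1≤∣S∣ , ∣S∣≤k , projected) = S , 1≤∣S∣ , ∣S∣≤k ,
      kernelCoordinate isPrime (toℕ ∘ f) σ j (n≢0⇒n>0 fⱼ≢0) (toℕ<n (f j)) p∣f·σ projected
      where
      σ : Fin (suc d) → ℕ
      σ m = sumOver S (λ i → toℕ (x (emb T i) m))
      p∣f·σ : p ∣ (toℕ ∘ f) · σ
      p∣f·σ = subst (p ∣_) (sym (·-sumOver (toℕ ∘ f) S (λ i m → toℕ (x (emb T i) m))))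
        (sumOver-divisible S _ (select-member (λ i → p ∣? f ·ᵥ x i)))

  hyperplaneStep : ∀ {k d} → 1 ≤ k → ∀ A B →
    (∀ N → A < N * B → AllHaveShortZeroSum p d k N) →
    ∀ N → (p ^ suc d ∸ 1) * A < N * B * (p ^ d ∸ 1) → AllHaveShortZeroSum p (suc d) k N
  hyperplaneStep {k} {d} k≥1 A B shortBeyond N beyond x
    with any? (λ i → isZero (x i) ≟ᵇ true)
  ... | yes (i , xᵢ≡0) = zeroTerm k≥1 x i (isZero-true (x i) xᵢ≡0)
  ... | no noZeroTerm with largeKernel-or-bound x A B
  ...   | inj₁ (f , f≢0 , large) =
          zeroSumInKernel x f f≢0 (shortBeyond _ (subst (A <_) (*-comm B _) large))
  ...   | inj₂ bound = ⊥-elim (averaging-contradiction {A} {B} {N}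
          (m^n>0 p d) (m^n>0 p (suc d)) beyond
          (≤-trans (+-monoˡ-≤ A (*-monoʳ-≤ B (kernelTotal x nonzero))) bound))
    where
    nonzero : ∀ i → isZero (x i) ≡ false
    nonzero i = ¬-not (λ xᵢ≡0 → noZeroTerm (i , xᵢ≡0))

p^n∸1≥1 : ∀ {p n} → Prime p → 1 ≤ n → 1 ≤ p ^ n ∸ 1
p^n∸1≥1 {p} {n} isPrime n≥1 = m<n⇒0<n∸m (<-≤-trans 1<p p≤p^n)
  where
  instance
    p≢0 : NonZero p
    p≢0 = prime⇒nonZero isPrime
  1<p : 1 < p
  1<p = nonTrivial⇒n>1 p {{prime⇒nonTrivial isPrime}}
  p≤p^n : p ≤ p ^ n
  p≤p^n = ≤-trans (≤-reflexive (sym (*-identityʳ p))) (^-monoʳ-≤ p n≥1)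

threshold : ∀ {p k a sa d} → Prime p → 1 ≤ k → 1 ≤ a →
  AllHaveShortZeroSum p a k sa → a ≤′ d →
  ∀ N → (p ^ d ∸ 1) * (sa ∸ 1) < N * (p ^ a ∸ 1) → AllHaveShortZeroSum p d k N
threshold {p} {a = a} {sa} isPrime k≥1 a≥1 allₐ ≤′-refl N below =
  allHave-mono (≤N sa (*-cancelˡ-< (p ^ a ∸ 1) (sa ∸ 1) N below′)) allₐ
  where
  below′ : (p ^ a ∸ 1) * (sa ∸ 1) < (p ^ a ∸ 1) * N
  below′ = subst ((p ^ a ∸ 1) * (sa ∸ 1) <_) (*-comm N (p ^ a ∸ 1)) below
  ≤N : ∀ s → s ∸ 1 < N → s ≤ N
  ≤N zero _ = z≤n
  ≤N (suc s) s<N = s<N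
threshold {p} {a = a} {sa} {suc d} isPrime k≥1 a≥1 allₐ (≤′-step a≤′d) N below =
  HyperplaneStep.hyperplaneStep isPrime k≥1 ((p ^ d ∸ 1) * (sa ∸ 1)) (p ^ a ∸ 1)
    (threshold isPrime k≥1 a≥1 allₐ a≤′d) N scaled
  where
  instance
    p^d∸1≢0 : NonZero (p ^ d ∸ 1)
    p^d∸1≢0 = >-nonZero (p^n∸1≥1 isPrime (≤-trans a≥1 (≤′⇒≤ a≤′d)))
  reassociate : ∀ x y z → x * y * z ≡ x * (z * y)
  reassociate = solve-∀
  scaled : (p ^ suc d ∸ 1) * ((p ^ d ∸ 1) * (sa ∸ 1)) < N * (p ^ a ∸ 1) * (p ^ d ∸ 1)
  scaled = subst (_< N * (p ^ a ∸ 1) * (p ^ d ∸ 1))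
    (reassociate (p ^ suc d ∸ 1) (sa ∸ 1) (p ^ d ∸ 1)) (*-monoˡ-< (p ^ d ∸ 1) below)

lemma2p2 : (p k a d : ℕ) → Prime p → 1 ≤ k → 1 ≤ a → a ≤ d →
    (sa : ℕ) → IsSmallDavenport≤ p a k sa →
    Σ ℕ λ sd → IsSmallDavenport≤ p d k sd ×
    ((sd ∸ 1) * (p ^ a ∸ 1) ≤ (p ^ d ∸ 1) * (sa ∸ 1))
lemma2p2 p k a d isPrime k≥1 a≥1 a≤d sa (allₐ , _) =
  leastBelowThreshold (allHaveShortZeroSum? p d k) ((p ^ d ∸ 1) * (sa ∸ 1)) (p ^ a ∸ 1)
    (p^n∸1≥1 isPrime a≥1) (threshold isPrime k≥1 a≥1 allₐ (≤⇒≤′ a≤d))
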